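{- Let $G$ be a DAG with no idle edges, and let $F$ be an ample framing of $G$. Then every inner vertex $v$ of $G$ satisfies $\mathrm{indeg}(v)=2=\mathrm{outdeg}(v)$.
   Context: A DAG is a finite directed acyclic graph, possibly with multiple edges. For a vertex $v$, $\mathrm{in}(v)$ and $\mathrm{out}(v)$ are its sets of incoming and outgoing edges; $v$ is a source if $\mathrm{in}(v)=\emptyset$, a sink if $\mathrm{out}(v)=\emptyset$, and an inner vertex otherwise. An edge is idle if it is the only incoming edge or the only outgoing edge of some inner vertex. A route is a maximal directed path (from a source to a sink). A framing $F$ assigns to each inner vertex $v$ a linear order $\prec$ on $\mathrm{in}(v)$ and a linear order $\prec$ on $\mathrm{out}(v)$. For an inner vertex $v$, let $\mathrm{In}(v)$ be the set of directed paths from a source to $v$ and $\mathrm{Out}(v)$ the set of directed paths from $v$ to a sink. For distinct $P,Q\in\mathrm{Out}(v)$, let $w$ be the last vertex of their maximal common initial segment and $e_P\neq e_Q$ the edges of $P,Q$ leaving $w$; set $P\prec Q$ iff $e_P\prec e_Q$ in $\mathrm{out}(w)$. Analogously for $P,Q\in \mathrm{In}(v)$, using the first vertex $w$ of their maximal common final segment and the edges of $P,Q$ entering $w$, compared in $\mathrm{in}(w)$. For a route $R$ through $v$, $Rv$ is the part of $R$ from its source to $v$ and $vR$ the part from $v$ to its sink. Two routes $P,Q$ through a common inner vertex $v$ are in conflict at $v$ if, after possibly swapping $P$ and $Q$, $Pv\prec Qv$ in $\mathrm{In}(v)$ and $vQ\prec vP$ in $\mathrm{Out}(v)$; otherwise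 they are coherent at $v$. They are coherent if coherent at every common inner vertex. A route is exceptional if it is coherent with every route of $G$. The flow cone $\mathcal{F}_+(G)\subset\mathbb{R}^{E(G)}$ is the set of $f\geq 0$ with $\sum_{e\in\mathrm{in}(v)}f(e)=\sum_{e\in\mathrm{out}(v)}f(e)$ for all inner $v$; the characteristic vector $v_R$ of a route $R$ is the indicator vector of its edges. A framing $F$ is ample if the set $\{v_R: R \text{ exceptional}\}$ is not contained in any facet of $\mathcal{F}_+(G)$. (By a result of Danilov–Karzanov–Koshevoy, $F$ is ample iff every non-idle edge lies on some exceptional route.)
   Formalization: The flow cone $\mathcal{F}_+(G)$ in the definition of an ample framing is taken over the rationals instead of the reals, and the linear functionals cutting out its faces have rational coefficients. -}

module Defs where

open import Data.Nat using (ℕ; _<_)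
open import Data.Fin using (Fin)
open import Data.Fin.Properties using (_≟_)
open import Data.List using (List; []; _∷_; _++_; length; filter; foldr; reverse; allFin)
open import Data.Bool.ListAction using (any)
open import Data.Product using (Σ; ∃; ∃-syntax; _×_; _,_)
open import Data.Sum using (_⊎_)
open import Data.Unit using (⊤)
open import Data.Empty using (⊥)
open import Data.Bool using (if_then_else_)
open import Relation.Nullary using (¬_)
open import Relation.Nullary.Decidable using (⌊_⌋)
open import Relation.Binary.PropositionalEquality using (_≡_; _≢_)
open import Data.Rational using (ℚ; 0ℚ; 1ℚ; _+_; _*_; _≤_)

module _ {n m : ℕ} (src tgt : Fin m → Fin n) where

  Chain : List (Fin m) → Set
  Chain []             = ⊤
  Chain (e ∷ [])       = ⊤
  Chain (e ∷ e' ∷ p)   = tgt e ≡ src e' × Chain (e' ∷ p)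

  StartsAt : List (Fin m) → Fin n → Set
  StartsAt []      v = ⊥
  StartsAt (e ∷ p) v = src e ≡ v

  EndsAt : List (Fin m) → Fin n → Set
  EndsAt []           v = ⊥
  EndsAt (e ∷ [])     v = tgt e ≡ v
  EndsAt (e ∷ e' ∷ p) v = EndsAt (e' ∷ p) v

  Acyclic : Set
  Acyclic = ∀ (p : List (Fin m)) (v : Fin n) → Chain p → StartsAt p v → EndsAt p v → ⊥

record DAG : Set where
  field
    n m     : ℕ
    src tgt : Fin m → Fin n
    acyclic : Acyclic src tgt

module _ (G : DAG) where
  open DAG G

  Path : Set
  Path = List (Fin m)

  IsSource : Fin n → Set
  IsSource v = ∀ e → tgt e ≢ v

  IsSink : Fin n → Set
  IsSink v = ∀ e → src e ≢ v

  Inner : Fin n → Set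
  Inner v = ¬ IsSource v × ¬ IsSink v

  indeg : Fin n → ℕ
  indeg v = length (filter (λ e → tgt e ≟ v) (allFin m))

  outdeg : Fin n → ℕ
  outdeg v = length (filter (λ e → src e ≟ v) (allFin m))

  Idle : Fin m → Set
  Idle e = ∃[ v ] (Inner v ×
             ((tgt e ≡ v × (∀ e' → tgt e' ≡ v → e' ≡ e)) ⊎
              (src e ≡ v × (∀ e' → src e' ≡ v → e' ≡ e))))

  NoIdleEdges : Set
  NoIdleEdges = ∀ e → ¬ Idle e

  -- route = maximal directed path = directed path from a source to a sink
  Route : Path → Set
  Route R = Chain src tgt R
          × (∃[ s ] (IsSource s × StartsAt src tgt R s))
          × (∃[ t ] (IsSink t × EndsAt src tgt R t))

  -- Framing: a linear order on in(v) and on out(v) for every vertex v,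
  -- encoded by rankings injective on each in(v) / out(v).

  record Framing : Set where
    field
      rin    : Fin m → ℕ
      rout   : Fin m → ℕ
      rin-inj  : ∀ e e' → tgt e ≡ tgt e' → rin e ≡ rin e' → e ≡ e'
      rout-inj : ∀ e e' → src e ≡ src e' → rout e ≡ rout e' → e ≡ e'

  module _ (F : Framing) where
    open Framing F

    -- order on Out(v): compare at the first divergence (edges leaving w)
    OutLt : Path → Path → Set
    OutLt (e ∷ p) (e' ∷ q) = (e ≡ e' × OutLt p q) ⊎ (e ≢ e' × rout e < rout e')
    OutLt _ _ = ⊥

    -- on reversed paths: compare at the last divergence (edges entering w)
    InLtRev : Path → Path → Set
    InLtRev (e ∷ p) (e' ∷ q) = (e ≡ e' × InLtRev p q) ⊎ (e ≢ e' × rin e < rin e')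
    InLtRev _ _ = ⊥

    InLt : Path → Path → Set
    InLt P Q = InLtRev (reverse P) (reverse Q)

    -- P = Pv ++ vP, Q = Qv ++ vQ with Pv ≺ Qv in In(v) and vQ ≺ vP in Out(v)
    ConflictAt' : Path → Path → Fin n → Set
    ConflictAt' P Q v =
      ∃[ p₁ ] ∃[ q₁ ] ∃[ p₂ ] ∃[ q₂ ]
        (P ≡ p₁ ++ q₁ × Q ≡ p₂ ++ q₂ ×
         EndsAt src tgt p₁ v × EndsAt src tgt p₂ v ×
         InLt p₁ p₂ × OutLt q₂ q₁)

    ConflictAt : Path → Path → Fin n → Set
    ConflictAt P Q v = Inner v × (ConflictAt' P Q v ⊎ ConflictAt' Q P v)

    Coherent : Path → Path → Set
    Coherent P Q = ∀ v → ¬ ConflictAt P Q v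

    Exceptional : Path → Set
    Exceptional R = ∀ Q → Route Q → Coherent R Q

  sumℚ : List ℚ → ℚ
  sumℚ = foldr _+_ 0ℚ

  inflow : (Fin m → ℚ) → Fin n → ℚ
  inflow f v = sumℚ (Data.List.map f (filter (λ e → tgt e ≟ v) (allFin m)))

  outflow : (Fin m → ℚ) → Fin n → ℚ
  outflow f v = sumℚ (Data.List.map f (filter (λ e → src e ≟ v) (allFin m)))

  InFlowCone : (Fin m → ℚ) → Set
  InFlowCone f = (∀ e → 0ℚ ≤ f e) × (∀ v → Inner v → inflow f v ≡ outflow f v)

  dot : (Fin m → ℚ) → (Fin m → ℚ) → ℚ
  dot c f = sumℚ (Data.List.map (λ e → c e * f e) (allFin m))

  charVec : Path → Fin m → ℚ
  charVec R e = if any (λ e' → ⌊ e ≟ e' ⌋) R then 1ℚ else 0ℚ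

  -- F is ample: the characteristic vectors of exceptional routes are not
  -- contained in any proper face (equivalently, any facet) of the flow cone.
  -- A face is cut out by a linear functional c ≥ 0 on the cone; it is proper
  -- iff c does not vanish on the whole cone.
  Ample : Framing → Set
  Ample F = ∀ (c : Fin m → ℚ)
          → (∀ f → InFlowCone f → 0ℚ ≤ dot c f)
          → (∀ R → Route R → Exceptional F R → dot c (charVec R) ≡ 0ℚ)
          → ∀ f → InFlowCone f → dot c f ≡ 0ℚ

{-# OPTIONS --safe #-}
-- Suppose an inner vertex v had three in-edges lo ≺ a ≺ hi.  A route R through a leaves v by
-- some b, and v has a second out-edge b′ since no edge is idle.  If b′ ≺ b, the route through
-- hi and b′ conflicts with R at v; if b ≺ b′, so does the route through lo and b′.  Hence no
-- exceptional route uses a, so the functional f ↦ f(a), which is nonnegative on the flow cone,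
-- vanishes on every exceptional route; by ampleness it vanishes on the whole cone, although it
-- is 1 on the flow of any route through a.  Out-edges are dual, and the absence of idle edges
-- also rules out in- and out-degree 1.
module Submission where

open import Defs
open import Data.Nat using (ℕ; zero; suc; _<_)
open import Data.Nat.Properties using (<-irrefl; <-cmp)
open import Data.Fin using (Fin; zero; suc)
open import Data.Fin.Properties using (_≟_; any?; injective⇒≤)
open import Data.List using (List; []; _∷_; _++_; [_]; _∷ʳ_; length; reverse; filter; allFin; map; foldr)
open import Data.List.Properties using (unfold-reverse; reverse-++; ∷ʳ-++)
open import Data.List.Membership.Propositional using (_∈_; _∉_; find; lose)
open import Data.List.Membership.Propositional.Properties using (∈-++⁺ʳ; ∈-filter⁺; ∈-filter⁻; ∈-allFin)
open import Data.List.Relation.Unary.Any as Any using (here; there)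
open import Data.List.Relation.Unary.Any.Properties using (any⁺; any⁻)
open import Data.List.Relation.Unary.All as All using (_∷_)
open import Data.List.Relation.Unary.AllPairs using (_∷_)
open import Data.List.Relation.Unary.Unique.Propositional using (Unique)
open import Data.List.Relation.Unary.Unique.Propositional.Properties using (allFin⁺; filter⁺)
open import Data.Bool.ListAction using (any)
open import Data.Bool using (true; false; T)
open import Data.Product using (∃₂; ∃-syntax; _×_; _,_; proj₂)
open import Data.Sum as Sum using (_⊎_; inj₁; inj₂)
open import Data.Unit using (tt)
open import Data.Empty using (⊥; ⊥-elim)
open import Data.Rational using (ℚ; 0ℚ; 1ℚ; _+_; _*_; _≤_)
import Data.Rational.Properties as ℚ
open import Function.Definitions using (Injective)
open import Relation.Nullary using (¬_; yes; no)
open import Relation.Nullary.Decidable using (⌊_⌋; _×-dec_; ¬?; decidable-stable; toWitness; fromWitness)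
open import Relation.Binary.Definitions using (tri<; tri≈; tri>)
open import Relation.Binary.PropositionalEquality hiding ([_])

private
  variable
    n m : ℕ
    u v s t : Fin n
    e x y z a b a′ b′ lo hi : Fin m
    p q xs ys xs′ ys′ : List (Fin m)

data Walk (src tgt : Fin m → Fin n) : Fin n → Fin n → List (Fin m) → Set where
  []  : Walk src tgt u u []
  _∷_ : src e ≡ u → Walk src tgt (tgt e) t p → Walk src tgt u t (e ∷ p)

module _ {src tgt : Fin m → Fin n} where

  _++ʷ_ : Walk src tgt u v p → Walk src tgt v t q → Walk src tgt u t (p ++ q)
  [] ++ʷ w′ = w′
  (s′ ∷ w) ++ʷ w′ = s′ ∷ (w ++ʷ w′)

  ∈-split : Walk src tgt u t p → x ∈ p →
            ∃₂ λ xs ys → p ≡ xs ++ x ∷ ys × Walk src tgt u (src x) xs × Walk src tgt (tgt x) t ys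
  ∈-split (refl ∷ w) (here refl) = [] , _ , refl , [] , w
  ∈-split (refl ∷ w) (there x∈p) =
    let xs , ys , eq , w₁ , w₂ = ∈-split w x∈p in _ ∷ xs , ys , cong (_ ∷_) eq , refl ∷ w₁ , w₂

  last-edge : Walk src tgt u t (e ∷ p) → ∃₂ λ init a → e ∷ p ≡ init ∷ʳ a × tgt a ≡ t
  last-edge (_ ∷ []) = [] , _ , refl , refl
  last-edge {e = e} (_ ∷ w@(_ ∷ _)) =
    let init , a , eq , end = last-edge w in e ∷ init , a , cong (e ∷_) eq , end

  walk⇒chain : Walk src tgt u t p → Chain src tgt p
  walk⇒chain [] = tt
  walk⇒chain (_ ∷ []) = tt
  walk⇒chain (_ ∷ w@(s′ ∷ _)) = sym s′ , walk⇒chain w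

  walk⇒ends : Walk src tgt u t (e ∷ p) → EndsAt src tgt (e ∷ p) t
  walk⇒ends (_ ∷ []) = refl
  walk⇒ends (_ ∷ w@(_ ∷ _)) = walk⇒ends w

  chain⇒walk : Chain src tgt (e ∷ p) → src e ≡ u → EndsAt src tgt (e ∷ p) t → Walk src tgt u t (e ∷ p)
  chain⇒walk {p = []} _ s′ refl = s′ ∷ []
  chain⇒walk {p = _ ∷ _} (link , c) s′ end = s′ ∷ chain⇒walk c (sym link) end

  acyclic⇒¬closed : Acyclic src tgt → x ∈ p → ¬ Walk src tgt u u p
  acyclic⇒¬closed acyc () []
  acyclic⇒¬closed acyc _ w@(s′ ∷ _) = acyc _ _ (walk⇒chain w) s′ (walk⇒ends w)

reverse-walk : {src tgt : Fin m → Fin n} → Walk src tgt u t p → Walk tgt src t u (reverse p)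
reverse-walk [] = []
reverse-walk {p = e ∷ p} (refl ∷ w) =
  subst (Walk _ _ _ _) (sym (unfold-reverse e p)) (reverse-walk w ++ʷ (refl ∷ []))

acyclic-reverse : {src tgt : Fin m → Fin n} → Acyclic src tgt → Acyclic tgt src
acyclic-reverse acyc (e ∷ p) _ c s′ end =
  acyclic⇒¬closed acyc (∈-++⁺ʳ (reverse p) (here refl))
    (subst (Walk _ _ _ _) (unfold-reverse e p) (reverse-walk (chain⇒walk c s′ end)))

module _ {src tgt : Fin m → Fin n} where

  vertexAt : Walk src tgt u t p → Fin (suc (length p)) → Fin n
  vertexAt {u = u} _ zero = u
  vertexAt (_ ∷ w) (suc i) = vertexAt w i

  prefix : (w : Walk src tgt u t p) (i : Fin (suc (length p))) → ∃[ q ] Walk src tgt u (vertexAt w i) q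
  prefix _ zero = [] , []
  prefix (s′ ∷ w) (suc i) = let q , w′ = prefix w i in _ ∷ q , s′ ∷ w′

  sink-or-length : (k : ℕ) (u : Fin n) →
                   ∃₂ λ t p → Walk src tgt u t p × ((∀ e → src e ≢ t) ⊎ length p ≡ k)
  sink-or-length zero u = u , [] , [] , inj₂ refl
  sink-or-length (suc k) u with any? (λ e → src e ≟ u)
  ... | no ∄out = u , [] , [] , inj₁ (λ e s′ → ∄out (e , s′))
  ... | yes (e , s′) with sink-or-length k (tgt e)
  ...   | t , p , w , inj₁ sink = t , e ∷ p , s′ ∷ w , inj₁ sink
  ...   | t , p , w , inj₂ len = t , e ∷ p , s′ ∷ w , inj₂ (cong suc len)

  module _ (acyc : Acyclic src tgt) where

    later-vertex≢start : src e ≡ u → (w : Walk src tgt (tgt e) t p) (j : Fin (suc (length p))) →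
                         vertexAt w j ≢ u
    later-vertex≢start s′ w j eq = let q , w′ = prefix w j in
      acyclic⇒¬closed acyc (here refl) (subst (λ v → Walk src tgt _ v (_ ∷ q)) eq (s′ ∷ w′))

    vertexAt-injective : (w : Walk src tgt u t p) → Injective _≡_ _≡_ (vertexAt w)
    vertexAt-injective w {zero} {zero} _ = refl
    vertexAt-injective (s′ ∷ w) {zero} {suc j} eq = ⊥-elim (later-vertex≢start s′ w j (sym eq))
    vertexAt-injective (s′ ∷ w) {suc i} {zero} eq = ⊥-elim (later-vertex≢start s′ w i eq)
    vertexAt-injective (_ ∷ w) {suc i} {suc j} eq = cong suc (vertexAt-injective w eq)

    walk-length< : Walk src tgt u t p → length p < n
    walk-length< w = injective⇒≤ (vertexAt-injective w)

    -- Walks have fewer than n edges, so following out-edges for n steps must get stuck at a sink.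
    walk-to-sink : ∀ u → ∃₂ λ t p → Walk src tgt u t p × (∀ e → src e ≢ t)
    walk-to-sink u with sink-or-length n u
    ... | t , p , w , inj₁ sink = t , p , w , sink
    ... | t , p , w , inj₂ len = ⊥-elim (<-irrefl len (walk-length< w))

    later-tgt≢ : Walk src tgt (tgt e) t p → y ∈ p → tgt y ≢ tgt e
    later-tgt≢ {e = e} {y = y} w y∈p eq = let xs , _ , _ , w₁ , _ = ∈-split w y∈p in
      acyclic⇒¬closed acyc (∈-++⁺ʳ xs (here refl))
        (subst (λ v → Walk src tgt (tgt e) v (xs ∷ʳ y)) eq (w₁ ++ʷ (refl ∷ [])))

    later-src≢ : Walk src tgt (tgt e) t p → y ∈ p → src y ≢ src e
    later-src≢ {e = e} w y∈p eq = let xs , _ , _ , w₁ , _ = ∈-split w y∈p in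
      acyclic⇒¬closed acyc (here refl) (subst (λ v → Walk src tgt (src e) v (e ∷ xs)) eq (refl ∷ w₁))

    walk-tgt-injective : Walk src tgt u t p → x ∈ p → y ∈ p → tgt x ≡ tgt y → x ≡ y
    walk-tgt-injective (_ ∷ w) (here refl) (here refl) _  = refl
    walk-tgt-injective (_ ∷ w) (here refl) (there y∈p) eq = ⊥-elim (later-tgt≢ w y∈p (sym eq))
    walk-tgt-injective (_ ∷ w) (there x∈p) (here refl) eq = ⊥-elim (later-tgt≢ w x∈p eq)
    walk-tgt-injective (_ ∷ w) (there x∈p) (there y∈p) eq = walk-tgt-injective w x∈p y∈p eq

    walk-src-injective : Walk src tgt u t p → x ∈ p → y ∈ p → src x ≡ src y → x ≡ y
    walk-src-injective (_ ∷ w) (here refl) (here refl) _  = refl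
    walk-src-injective (_ ∷ w) (here refl) (there y∈p) eq = ⊥-elim (later-src≢ w y∈p (sym eq))
    walk-src-injective (_ ∷ w) (there x∈p) (here refl) eq = ⊥-elim (later-src≢ w x∈p eq)
    walk-src-injective (_ ∷ w) (there x∈p) (there y∈p) eq = walk-src-injective w x∈p y∈p eq

module _ {A : Set} (g : A → ℚ) where

  sum-zero : ∀ L → (∀ {y} → y ∈ L → g y ≡ 0ℚ) → foldr _+_ 0ℚ (map g L) ≡ 0ℚ
  sum-zero [] _ = refl
  sum-zero (y ∷ L) zeros =
    trans (cong₂ _+_ (zeros (here refl)) (sum-zero L (λ y∈L → zeros (there y∈L)))) (ℚ.+-identityʳ 0ℚ)

  sum-single : ∀ {L x} → Unique L → x ∈ L → (∀ {y} → y ∈ L → y ≢ x → g y ≡ 0ℚ) →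
               foldr _+_ 0ℚ (map g L) ≡ g x
  sum-single {_ ∷ L} {x} (x≢L ∷ _) (here refl) zeros =
    trans (cong (g x +_) (sum-zero L (λ y∈L → zeros (there y∈L) (λ y≡x → All.lookup x≢L y∈L (sym y≡x)))))
          (ℚ.+-identityʳ (g x))
  sum-single {y ∷ _} {x} (y≢L ∷ unique) (there x∈L) zeros =
    trans (cong₂ _+_ (zeros (here refl) (All.lookup y≢L x∈L)) (sum-single unique x∈L (λ z∈L → zeros (there z∈L))))
          (ℚ.+-identityˡ (g x))

module _ (f : Fin m → Fin n) (v : Fin n) where

  Fiber : List (Fin m)
  Fiber = filter (λ e → f e ≟ v) (allFin m)

  fiber-unique : Unique Fiber
  fiber-unique = filter⁺ (λ e → f e ≟ v) (allFin⁺ m)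

  ∈-fiber⁺ : f e ≡ v → e ∈ Fiber
  ∈-fiber⁺ {e = e} fe = ∈-filter⁺ (λ e → f e ≟ v) (∈-allFin e) fe

  ∈-fiber⁻ : e ∈ Fiber → f e ≡ v
  ∈-fiber⁻ e∈ = proj₂ (∈-filter⁻ (λ e → f e ≟ v) {xs = allFin m} e∈)

  fiber-inhabited : ¬ (∀ e → f e ≢ v) → ∃[ e ] f e ≡ v
  fiber-inhabited ¬empty with any? (λ e → f e ≟ v)
  ... | yes found = found
  ... | no ∄e = ⊥-elim (¬empty (λ e fe → ∄e (e , fe)))

  fiber-another : ¬ (∀ e′ → f e′ ≡ v → e′ ≡ e) → ∃[ e′ ] f e′ ≡ v × e′ ≢ e
  fiber-another {e = e} ¬unique with any? (λ e′ → (f e′ ≟ v) ×-dec ¬? (e′ ≟ e))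
  ... | yes found = found
  ... | no ∄e′ = ⊥-elim (¬unique (λ e′ fe′ → decidable-stable (e′ ≟ e) (λ e′≢e → ∄e′ (e′ , fe′ , e′≢e))))

module _ (f : Fin m → Fin n) (rank : Fin m → ℕ) {v : Fin n}
         (rank-injective : ∀ e e′ → f e ≡ f e′ → rank e ≡ rank e′ → e ≡ e′)
         (no-middle : ∀ {lo e hi} → f lo ≡ v → f e ≡ v → f hi ≡ v → rank lo < rank e → rank e < rank hi → ⊥)
         where

  ¬three-in-fiber : f x ≡ v → f y ≡ v → f z ≡ v → x ≢ y → y ≢ z → x ≢ z → ⊥
  ¬three-in-fiber {x} {y} {z} fx fy fz x≢y y≢z x≢z
    with <-cmp (rank x) (rank y) | <-cmp (rank y) (rank z) | <-cmp (rank x) (rank z)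
  ... | tri≈ _ eq _ | _ | _ = x≢y (rank-injective x y (trans fx (sym fy)) eq)
  ... | _ | tri≈ _ eq _ | _ = y≢z (rank-injective y z (trans fy (sym fz)) eq)
  ... | _ | _ | tri≈ _ eq _ = x≢z (rank-injective x z (trans fx (sym fz)) eq)
  ... | tri< x<y _ _ | tri< y<z _ _ | _             = no-middle fx fy fz x<y y<z
  ... | tri> _ _ y<x | tri> _ _ z<y | _             = no-middle fz fy fx z<y y<x
  ... | tri< x<y _ _ | tri> _ _ z<y | tri< x<z _ _ = no-middle fx fz fy x<z z<y
  ... | tri< x<y _ _ | tri> _ _ z<y | tri> _ _ z<x = no-middle fz fx fy z<x x<y
  ... | tri> _ _ y<x | tri< y<z _ _ | tri< x<z _ _ = no-middle fy fx fz y<x x<z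
  ... | tri> _ _ y<x | tri< y<z _ _ | tri> _ _ z<x = no-middle fy fz fx y<z z<x

  private
    length≡2 : ∀ L → Unique L → (∀ {e} → e ∈ L → f e ≡ v) → x ∈ L → y ∈ L → x ≢ y → length L ≡ 2
    length≡2 (_ ∷ []) _ _ (here refl) (here refl) x≢y = ⊥-elim (x≢y refl)
    length≡2 (_ ∷ _ ∷ []) _ _ _ _ _ = refl
    length≡2 (_ ∷ _ ∷ _ ∷ _) ((x≢y ∷ x≢z ∷ _) ∷ (y≢z ∷ _) ∷ _) in-fiber _ _ _ =
      ⊥-elim (¬three-in-fiber (in-fiber (here refl)) (in-fiber (there (here refl)))
                              (in-fiber (there (there (here refl)))) x≢y y≢z x≢z)

  fiber-length≡2 : f x ≡ v → f y ≡ v → x ≢ y → length (Fiber f v) ≡ 2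
  fiber-length≡2 fx fy =
    length≡2 (Fiber f v) (fiber-unique f v) (∈-fiber⁻ f v) (∈-fiber⁺ f v fx) (∈-fiber⁺ f v fy)

module _ (G : DAG) where
  open DAG G using (src; tgt; acyclic)

  source-to : ∀ u → ∃₂ λ s p → Walk src tgt s u p × IsSource G s
  source-to u =
    let s , p , w , source = walk-to-sink (acyclic-reverse acyclic) u in s , reverse p , reverse-walk w , source

  to-sink : ∀ u → ∃₂ λ t p → Walk src tgt u t p × IsSink G t
  to-sink = walk-to-sink acyclic

  route⇒walk : ∀ {R} → Route G R → ∃₂ λ s t → Walk src tgt s t R × IsSource G s × IsSink G t
  route⇒walk {_ ∷ _} (chain , (s , source , starts) , (t , sink , ends)) =
    s , t , chain⇒walk chain starts ends , source , sink

  walk⇒route : IsSource G s → IsSink G t → Walk src tgt s t (e ∷ p) → Route G (e ∷ p)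
  walk⇒route source sink w@(starts ∷ _) = walk⇒chain w , (_ , source , starts) , (_ , sink , walk⇒ends w)

  extend-to-route : Walk src tgt u v (e ∷ p) → ∃₂ λ xs ys → Route G (xs ++ e ∷ p ++ ys)
  extend-to-route {u = u} {v = v} {e = e} {p = p} middle with source-to u | to-sink v
  ... | s , xs , before , source | t , ys , after , sink = xs , ys , route xs (before ++ʷ (middle ++ʷ after))
    where
    route : ∀ xs → Walk src tgt s t (xs ++ e ∷ p ++ ys) → Route G (xs ++ e ∷ p ++ ys)
    route [] = walk⇒route source sink
    route (_ ∷ _) = walk⇒route source sink

  route-through : tgt a ≡ src b → ∃₂ λ xs ys → Route G (xs ++ a ∷ b ∷ ys)
  route-through link = extend-to-route (refl ∷ sym link ∷ [])

  edge-on-route : ∀ e → ∃[ R ] Route G R × e ∈ R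
  edge-on-route e = let xs , _ , route = extend-to-route (refl ∷ []) in _ , route , ∈-++⁺ʳ xs (here refl)

  route-continues : ∀ {R} → Route G R → x ∈ R → tgt x ≡ v → ¬ IsSink G v →
                    ∃[ y ] ∃₂ λ xs ys → R ≡ xs ++ x ∷ y ∷ ys × src y ≡ v
  route-continues route x∈R tx ¬sink with route⇒walk route
  ... | _ , _ , w , _ , sink with ∈-split w x∈R
  ...   | _ , [] , _ , _ , [] = ⊥-elim (¬sink (subst (IsSink G) tx sink))
  ...   | xs , y ∷ ys , eq , _ , sy ∷ _ = y , xs , ys , eq , trans sy tx

  route-preceded : ∀ {R} → Route G R → y ∈ R → src y ≡ v → ¬ IsSource G v →
                   ∃[ x ] ∃₂ λ xs ys → R ≡ xs ++ x ∷ y ∷ ys × tgt x ≡ v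
  route-preceded {y = y} route y∈R sy ¬source with route⇒walk route
  ... | _ , _ , w , source , _ with ∈-split w y∈R
  ...   | [] , _ , _ , [] , _ = ⊥-elim (¬source (subst (IsSource G) sy source))
  ...   | xs@(_ ∷ _) , ys , eq , before , _ with last-edge before
  ...     | init , x , xs≡ , tx =
    x , init , ys , trans eq (trans (cong (_++ y ∷ ys) xs≡) (∷ʳ-++ init x (y ∷ ys))) , trans tx sy

  route-tgt-injective : ∀ {R} → Route G R → x ∈ R → y ∈ R → tgt x ≡ tgt y → x ≡ y
  route-tgt-injective route = let _ , _ , w , _ = route⇒walk route in walk-tgt-injective acyclic w

  route-src-injective : ∀ {R} → Route G R → x ∈ R → y ∈ R → src x ≡ src y → x ≡ y
  route-src-injective route = let _ , _ , w , _ = route⇒walk route in walk-src-injective acyclic w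

  ends-∷ʳ : ∀ xs → EndsAt src tgt (xs ∷ʳ a) (tgt a)
  ends-∷ʳ [] = refl
  ends-∷ʳ (_ ∷ []) = refl
  ends-∷ʳ (_ ∷ x ∷ xs) = ends-∷ʳ (x ∷ xs)

  charVec-∈ : ∀ {R} → e ∈ R → charVec G R e ≡ 1ℚ
  charVec-∈ {e = e} {R} e∈R
    with any (λ e′ → ⌊ e ≟ e′ ⌋) R | any⁺ (λ e′ → ⌊ e ≟ e′ ⌋) (Any.map fromWitness e∈R)
  ... | true | _ = refl

  charVec-∉ : ∀ {R} → e ∉ R → charVec G R e ≡ 0ℚ
  charVec-∉ {e = e} {R} e∉R with any (λ e′ → ⌊ e ≟ e′ ⌋) R in found
  ... | false = refl
  ... | true = ⊥-elim (e∉R (Any.map toWitness (any⁻ _ R (subst T (sym found) tt))))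

  charVec-nonneg : ∀ R → 0ℚ ≤ charVec G R e
  charVec-nonneg {e = e} R with any (λ e′ → ⌊ e ≟ e′ ⌋) R
  ... | true = ℚ.nonNegative⁻¹ 1ℚ
  ... | false = ℚ.≤-refl

  module _ (f : Fin (DAG.m G) → Fin (DAG.n G)) {v : Fin (DAG.n G)} {R : Path G} where

    fiber-charVec-sum≡1 : (∀ {x y} → x ∈ R → y ∈ R → f x ≡ f y → x ≡ y) → x ∈ R → f x ≡ v →
                          foldr _+_ 0ℚ (map (charVec G R) (Fiber f v)) ≡ 1ℚ
    fiber-charVec-sum≡1 f-injective x∈R fx =
      trans (sum-single (charVec G R) (fiber-unique f v) (∈-fiber⁺ f v fx) off-x) (charVec-∈ x∈R)
      where
      off-x : ∀ {y} → y ∈ Fiber f v → y ≢ _ → charVec G R y ≡ 0ℚ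
      off-x y∈ y≢x = charVec-∉ (λ y∈R → y≢x (f-injective y∈R x∈R (trans (∈-fiber⁻ f v y∈) (sym fx))))

    fiber-charVec-sum≡0 : (∀ {x} → x ∈ R → f x ≢ v) → foldr _+_ 0ℚ (map (charVec G R) (Fiber f v)) ≡ 0ℚ
    fiber-charVec-sum≡0 avoids =
      sum-zero (charVec G R) (Fiber f v) (λ y∈ → charVec-∉ (λ y∈R → avoids y∈R (∈-fiber⁻ f v y∈)))

  route-conserves : ∀ {R} → Route G R → Inner G v → inflow G (charVec G R) v ≡ outflow G (charVec G R) v
  route-conserves {v = v} {R} route (¬source , ¬sink) with Any.any? (λ e → tgt e ≟ v) R
  ... | yes enters with find enters
  ...   | x , x∈R , tx with route-continues route x∈R tx ¬sink
  ...     | y , xs , ys , refl , sy =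
    trans (fiber-charVec-sum≡1 tgt (route-tgt-injective route) x∈R tx)
          (sym (fiber-charVec-sum≡1 src (route-src-injective route) (∈-++⁺ʳ xs (there (here refl))) sy))
  route-conserves {v = v} {R} route (¬source , ¬sink) | no ¬enters =
    trans (fiber-charVec-sum≡0 tgt (λ x∈R tx → ¬enters (lose x∈R tx)))
          (sym (fiber-charVec-sum≡0 src ¬leaves))
    where
    ¬leaves : ∀ {y} → y ∈ R → src y ≢ v
    ¬leaves y∈R sy with route-preceded route y∈R sy ¬source
    ... | x , xs , _ , refl , tx = ¬enters (lose (∈-++⁺ʳ xs (here refl)) tx)

  route∈flowCone : ∀ {R} → Route G R → InFlowCone G (charVec G R)
  route∈flowCone {R} route = (λ _ → charVec-nonneg R) , (λ _ → route-conserves route)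

  dot-charVec-edge : ∀ f → dot G (charVec G [ e ]) f ≡ f e
  dot-charVec-edge {e = e} f =
    trans (sum-single (λ y → charVec G [ e ] y * f y) (allFin⁺ _) (∈-allFin e) off-e)
          (trans (cong (_* f e) (charVec-∈ {R = [ e ]} (here refl))) (ℚ.*-identityˡ (f e)))
    where
    off-e : ∀ {y} → y ∈ allFin _ → y ≢ e → charVec G [ e ] y * f y ≡ 0ℚ
    off-e {y} _ y≢e = trans (cong (_* f y) (charVec-∉ {R = [ e ]} λ { (here y≡e) → y≢e y≡e })) (ℚ.*-zeroˡ (f y))

  module _ (F : Framing G) where
    open Framing F

    Avoided : Fin (DAG.m G) → Set
    Avoided e = ∀ R → Route G R → Exceptional G F R → e ∉ R

    ample⇒¬avoided : Ample G F → ∀ e → ¬ Avoided e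
    ample⇒¬avoided ample e avoided with edge-on-route e
    ... | R , route , e∈R = ℚ.1≢0 (begin
      1ℚ                                    ≡⟨ charVec-∈ e∈R ⟨
      charVec G R e                         ≡⟨ dot-charVec-edge (charVec G R) ⟨
      dot G (charVec G [ e ]) (charVec G R) ≡⟨ ample (charVec G [ e ]) nonneg vanishes (charVec G R) (route∈flowCone route) ⟩
      0ℚ                                    ∎)
      where
      open ≡-Reasoning
      nonneg : ∀ f → InFlowCone G f → 0ℚ ≤ dot G (charVec G [ e ]) f
      nonneg f (f≥0 , _) = subst (0ℚ ≤_) (sym (dot-charVec-edge f)) (f≥0 e)
      vanishes : ∀ R → Route G R → Exceptional G F R → dot G (charVec G [ e ]) (charVec G R) ≡ 0ℚ
      vanishes R route exceptional = trans (dot-charVec-edge (charVec G R)) (charVec-∉ (avoided R route exceptional))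

    Crosses : (a b a′ b′ : Fin (DAG.m G)) → Set
    Crosses a b a′ b′ = rin a < rin a′ × rout b′ < rout b

    crossing⇒conflict : tgt a ≡ v → tgt a′ ≡ v → Crosses a b a′ b′ →
                        ConflictAt' G F (xs ++ a ∷ b ∷ ys) (xs′ ++ a′ ∷ b′ ∷ ys′) v
    crossing⇒conflict {a = a} {a′ = a′} {b = b} {b′ = b′} {xs = xs} {ys = ys} {xs′ = xs′} {ys′ = ys′}
                      ta ta′ (a<a′ , b′<b) =
      xs ∷ʳ a , b ∷ ys , xs′ ∷ʳ a′ , b′ ∷ ys′ ,
      sym (∷ʳ-++ xs a (b ∷ ys)) , sym (∷ʳ-++ xs′ a′ (b′ ∷ ys′)) ,
      subst (EndsAt src tgt (xs ∷ʳ a)) ta (ends-∷ʳ xs) , subst (EndsAt src tgt (xs′ ∷ʳ a′)) ta′ (ends-∷ʳ xs′) ,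
      subst₂ (InLtRev G F) (sym (reverse-++ xs [ a ])) (sym (reverse-++ xs′ [ a′ ])) (inj₂ (rank<⇒≢ rin a<a′ , a<a′)) ,
      inj₂ (rank<⇒≢ rout b′<b , b′<b)
      where
      rank<⇒≢ : (rank : Fin (DAG.m G) → ℕ) → rank x < rank y → x ≢ y
      rank<⇒≢ _ x<y refl = <-irrefl refl x<y

    exceptional⇒¬crosses : Exceptional G F (xs ++ a ∷ b ∷ ys) → Inner G v →
                           tgt a ≡ v → tgt a′ ≡ v → src b′ ≡ v → ¬ (Crosses a b a′ b′ ⊎ Crosses a′ b′ a b)
    exceptional⇒¬crosses exceptional inner ta ta′ sb′ crossing =
      let _ , _ , route = route-through (trans ta′ (sym sb′)) in
      exceptional _ route _ (inner , Sum.map (crossing⇒conflict ta ta′) (crossing⇒conflict ta′ ta) crossing)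

    module _ (no-idle : NoIdleEdges G) where

      other-in-edge : Inner G v → tgt a ≡ v → ∃[ a′ ] tgt a′ ≡ v × a′ ≢ a
      other-in-edge {v = v} inner ta = fiber-another tgt v (λ unique → no-idle _ (v , inner , inj₁ (ta , unique)))

      other-out-edge : Inner G v → src b ≡ v → ∃[ b′ ] src b′ ≡ v × b′ ≢ b
      other-out-edge {v = v} inner sb = fiber-another src v (λ unique → no-idle _ (v , inner , inj₂ (sb , unique)))

      middle-in-edge-avoided : Inner G v → tgt lo ≡ v → tgt a ≡ v → tgt hi ≡ v →
                               rin lo < rin a → rin a < rin hi → Avoided a
      middle-in-edge-avoided inner@(_ , ¬sink) tlo ta thi lo<a a<hi R route exceptional a∈R
        with route-continues route a∈R ta ¬sink
      ... | b , xs , ys , refl , sb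
        with other-out-edge inner sb
      ... | b′ , sb′ , b′≢b with <-cmp (rout b′) (rout b)
      ... | tri< b′<b _ _ = exceptional⇒¬crosses exceptional inner ta thi sb′ (inj₁ (a<hi , b′<b))
      ... | tri≈ _ eq _   = b′≢b (rout-inj b′ b (trans sb′ (sym sb)) eq)
      ... | tri> _ _ b<b′ = exceptional⇒¬crosses exceptional inner ta tlo sb′ (inj₂ (lo<a , b<b′))

      middle-out-edge-avoided : Inner G v → src lo ≡ v → src b ≡ v → src hi ≡ v →
                                rout lo < rout b → rout b < rout hi → Avoided b
      middle-out-edge-avoided inner@(¬source , _) slo sb shi lo<b b<hi R route exceptional b∈R
        with route-preceded route b∈R sb ¬source
      ... | a , xs , ys , refl , ta
        with other-in-edge inner ta
      ... | a′ , ta′ , a′≢a with <-cmp (rin a′) (rin a)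
      ... | tri< a′<a _ _ = exceptional⇒¬crosses exceptional inner ta ta′ shi (inj₂ (a′<a , b<hi))
      ... | tri≈ _ eq _   = a′≢a (rin-inj a′ a (trans ta′ (sym ta)) eq)
      ... | tri> _ _ a<a′ = exceptional⇒¬crosses exceptional inner ta ta′ slo (inj₁ (a<a′ , lo<b))

      module _ (ample : Ample G F) where

        indeg≡2 : Inner G v → indeg G v ≡ 2
        indeg≡2 {v = v} inner@(¬source , _) =
          let a , ta = fiber-inhabited tgt v ¬source
              a′ , ta′ , a′≢a = other-in-edge inner ta
          in fiber-length≡2 tgt rin rin-inj
               (λ tlo ta thi lo<a a<hi → ample⇒¬avoided ample _ (middle-in-edge-avoided inner tlo ta thi lo<a a<hi))
               ta′ ta a′≢a

        outdeg≡2 : Inner G v → outdeg G v ≡ 2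
        outdeg≡2 {v = v} inner@(_ , ¬sink) =
          let b , sb = fiber-inhabited src v ¬sink
              b′ , sb′ , b′≢b = other-out-edge inner sb
          in fiber-length≡2 src rout rout-inj
               (λ slo sb shi lo<b b<hi → ample⇒¬avoided ample _ (middle-out-edge-avoided inner slo sb shi lo<b b<hi))
               sb′ sb b′≢b

lemma3p1 : (G : DAG) → NoIdleEdges G → (F : Framing G) → Ample G F →
           ∀ v → Inner G v → indeg G v ≡ 2 × outdeg G v ≡ 2
lemma3p1 G no-idle F ample v inner = indeg≡2 G F no-idle ample inner , outdeg≡2 G F no-idle ample inner
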